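{- Let $f=S_{1,3}$. For every integer $n\ge 1$, the sequence $(f^k(n))_{k\ge 1}$ eventually enters the cycle $\{2,3\}$ (i.e. $(2,10_3)$, with $f(2)=3$, $f(3)=2$) if and only if at least one of the numbers $n$ and $2^{\#1(n)_3}$ has no digit $1$ in its ternary expansion; otherwise it eventually reaches the fixed point $4=11_3$.
   Context: For integers $t\ge 0$, $b\ge 2$, the $t$-shifted Sloane map in base $b$ is $S_{t,b}(n)=\prod_{i=0}^k (d_i+t)$, where $n=\sum_{i=0}^k d_ib^i$ is the base-$b$ expansion of $n$ ($0\le d_i\le b-1$, $d_k>0$). Thus $S_{1,3}(n)=2^{\#0(n)_3}3^{\#1(n)_3}\cdot$ … more precisely each ternary digit $d$ contributes a factor $d+1$. $\#1(n)_3$ denotes the number of digits equal to $1$ in the base-$3$ expansion of $n$. $f^k$ denotes the $k$-th iterate. -}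

module Defs where

open import Data.Nat using (ℕ; zero; suc; _≟_)
open import Data.List using (List; map; filter; length)
open import Data.Nat.ListAction using (product)
open import Data.List.Membership.Propositional using (_∈_)
open import Data.Digit using (toNatDigits)
open import Relation.Nullary using (¬_)

-- base-3 digits of n (most significant first; no leading zeros for n ≥ 1)
digits3 : ℕ → List ℕ
digits3 n = toNatDigits 3 n

S13 : ℕ → ℕ
S13 n = product (map suc (digits3 n))

ones3 : ℕ → ℕ
ones3 n = length (filter (_≟ 1) (digits3 n))

NoOne3 : ℕ → Set
NoOne3 n = ¬ (1 ∈ digits3 n)

iter : (ℕ → ℕ) → ℕ → ℕ → ℕ
iter f zero    x = x
iter f (suc k) x = f (iter f k x)

{-# OPTIONS --safe #-}
-- S13 n = 2^#1(n) · 3^#2(n), and a factor 3 only appends a digit 0, so S13 (S13 n) = S13 (2^a)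
-- with a = #1(n). If a = 0 this is S13 1 = 2. Otherwise b = #1(2^a) is even, since #1(m) ≡ m
-- (mod 2); if b = 0 the orbit reaches S13 (2^0) = 2 one step later, and otherwise
-- S13 (S13 n) = 4^s · 3^c with s ≥ 1. On such numbers S13 gives 4^s' · 3^c' with 2s' = #1(4^s),
-- where s' ≥ 1 because 4^s ≡ 1 (mod 3), and s' < s for s ≥ 2 because 4^s < 3^(2s-1). So the orbit
-- descends to the fixed point 4 = 11₃ and, staying ≥ 4, never meets the cycle {2, 3}.
module Submission where

open import Defs
open import Data.Nat
open import Data.Nat.Properties
open import Data.Nat.DivMod
open import Data.Nat.Divisibility using (_∣_; divides; ∣m∣n⇒∣m+n; ∣m+n∣m⇒∣n; n∣m*n; m∣m*n)
open import Data.Nat.Induction using (<-wellFounded-fast; <-rec)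
open import Data.Nat.ListAction using (product)
open import Data.Nat.ListAction.Properties using (product-++)
open import Data.Nat.Tactic.RingSolver using (solve-∀)
open import Induction.WellFounded using (Acc; acc; acc-inverse)
open import Data.List using (List; []; _∷_; _++_; map; filter; length)
open import Data.List.Properties using (++-assoc; map-++; filter-++; length-++; length-filter)
open import Algebra.Properties.CommutativeSemigroup *-commutativeSemigroup using () renaming (interchange to *-interchange)
open import Data.Bool using (true; false)
open import Data.Empty using (⊥-elim)
open import Data.Product using (_×_; _,_; ∃-syntax)
open import Data.Sum using (_⊎_; inj₁; inj₂; [_,_])
open import Data.List.Membership.Propositional using (_∈_; _∉_)
open import Data.List.Membership.Propositional.Properties using (∈-filter⁺; ∈-filter⁻)
open import Data.List.Relation.Unary.Any using (here)
open import Function.Bundles using (_⇔_; mk⇔)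
open import Relation.Nullary using (¬_; contradiction)
open import Function using (_∘_)
open import Relation.Binary.PropositionalEquality using (_≡_; refl; sym; trans; cong; cong₂; subst; module ≡-Reasoning)

/3< : ∀ m → suc m / 3 < suc m
/3< m = m/n<m (suc m) 3 (s≤s (s≤s z≤n))

-- toNatDigits recurses through a helper local to its where-block, which cannot be named.
-- digitsFrom is a metavariable that the with-abstraction below solves to that helper (its first
-- argument is the unused outer argument of toNatDigits), so that its accumulator can be reasoned about.
mutual
  digitsFrom : ℕ → {n : ℕ} → Acc _<_ n → List ℕ → List ℕ
  digitsFrom = _

  digits3-unfold : ∀ m → (0 <ᵇ suc m / 3) ≡ true →
    digits3 (suc m) ≡ digitsFrom (suc m) (acc-inverse (<-wellFounded-fast (suc m)) (/3< m)) (suc m % 3 ∷ [])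
  digits3-unfold m with 0 <ᵇ suc m / 3
  ... | true with suc m / 3 | acc-inverse (<-wellFounded-fast (suc m)) (/3< m) | suc m % 3 ∷ [] | suc m
  ...   | q | a | xs | N = λ _ → refl

digitsFrom-++ : ∀ N M {n} (a b : Acc _<_ n) xs → digitsFrom N a xs ≡ digitsFrom M b [] ++ xs
digitsFrom-++ N M {zero} a b xs = refl
digitsFrom-++ N M {suc m} (acc wa) (acc wb) xs with 0 <ᵇ suc m / 3
... | false = refl
... | true = begin
  digitsFrom N (wa (/3< m)) (r ∷ xs)                ≡⟨ digitsFrom-++ N M (wa (/3< m)) (wb (/3< m)) (r ∷ xs) ⟩
  digitsFrom M (wb (/3< m)) [] ++ r ∷ xs            ≡⟨ ++-assoc (digitsFrom M (wb (/3< m)) []) (r ∷ []) xs ⟨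
  (digitsFrom M (wb (/3< m)) [] ++ r ∷ []) ++ xs    ≡⟨ cong (_++ xs) (digitsFrom-++ M M (wb (/3< m)) (wb (/3< m)) (r ∷ [])) ⟨
  digitsFrom M (wb (/3< m)) (r ∷ []) ++ xs          ∎
  where open ≡-Reasoning
        r = suc m % 3

-- digits3 0 = 0 ∷ []; dropping that digit makes every expansion the one of n / 3 followed by n % 3.
digits3⁺ : ℕ → List ℕ
digits3⁺ zero = []
digits3⁺ n@(suc _) = digits3 n

digits3⁺-suc : ∀ m → digits3⁺ (suc m) ≡ digits3⁺ (suc m / 3) ++ suc m % 3 ∷ []
digits3⁺-suc m = by-leading-digit (0 <ᵇ suc m / 3) refl
  where
  q = suc m / 3
  by-leading-digit : ∀ b → (0 <ᵇ q) ≡ b → digits3 (suc m) ≡ digits3⁺ q ++ suc m % 3 ∷ []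
  by-leading-digit false lead rewrite lead = cong (_++ suc m % 3 ∷ []) (sym (empty {q} lead))
    where empty : ∀ {k} → (0 <ᵇ k) ≡ false → digits3⁺ k ≡ []
          empty {zero} _ = refl
  by-leading-digit true lead = begin
    digits3 (suc m)                                            ≡⟨ digits3-unfold m lead ⟩
    digitsFrom (suc m) (acc-inverse (<-wellFounded-fast (suc m)) (/3< m)) (suc m % 3 ∷ [])
      ≡⟨ digitsFrom-++ (suc m) q _ (<-wellFounded-fast q) _ ⟩
    digits3 q ++ suc m % 3 ∷ []                                ≡⟨ cong (_++ suc m % 3 ∷ []) (nonempty {q} lead) ⟩
    digits3⁺ q ++ suc m % 3 ∷ []                               ∎
    where open ≡-Reasoning
          nonempty : ∀ {k} → (0 <ᵇ k) ≡ true → digits3 k ≡ digits3⁺ k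
          nonempty {suc _} _ = refl

count3 : ℕ → ℕ → ℕ
count3 d n = length (filter (_≟ d) (digits3 n))

twos3 : ℕ → ℕ
twos3 = count3 2

digit-cases : (P : ℕ → Set) → P 0 → P 1 → P 2 → ∀ {r} → r < 3 → P r
digit-cases P p₀ p₁ p₂ {0} _ = p₀
digit-cases P p₀ p₁ p₂ {1} _ = p₁
digit-cases P p₀ p₁ p₂ {2} _ = p₂
digit-cases P p₀ p₁ p₂ {suc (suc (suc _))} (s≤s (s≤s (s≤s ())))

digits3-digit : ∀ {r} → r < 3 → digits3 r ≡ r ∷ []
digits3-digit = digit-cases (λ r → digits3 r ≡ r ∷ []) refl refl refl

digits3-split : ∀ m → digits3 (suc m) ≡ digits3⁺ (suc m / 3) ++ digits3 (suc m % 3)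
digits3-split m = trans (digits3⁺-suc m) (cong (digits3⁺ (suc m / 3) ++_) (sym (digits3-digit (m%n<n (suc m) 3))))

S13-/3 : ∀ n → S13 n ≡ S13 (n / 3) * S13 (n % 3)
S13-/3 zero = refl
S13-/3 n@(suc m) = begin
  product (map suc (digits3 n))                              ≡⟨ cong (product ∘ map suc) (digits3-split m) ⟩
  product (map suc (digits3⁺ q ++ digits3 r))                ≡⟨ cong product (map-++ suc (digits3⁺ q) (digits3 r)) ⟩
  product (map suc (digits3⁺ q) ++ map suc (digits3 r))      ≡⟨ product-++ (map suc (digits3⁺ q)) (map suc (digits3 r)) ⟩
  product (map suc (digits3⁺ q)) * S13 r                     ≡⟨ cong (_* S13 r) (S13-digits3⁺ q) ⟩
  S13 q * S13 r                                              ∎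
  where
  open ≡-Reasoning
  q = n / 3
  r = n % 3
  S13-digits3⁺ : ∀ q → product (map suc (digits3⁺ q)) ≡ S13 q
  S13-digits3⁺ zero = refl
  S13-digits3⁺ (suc _) = refl

-- False for the digit 0, because of the digit of digits3 0.
count3-/3 : ∀ d n → count3 (suc d) n ≡ count3 (suc d) (n / 3) + count3 (suc d) (n % 3)
count3-/3 d zero = refl
count3-/3 d n@(suc m) = begin
  length (filter P? (digits3 n))                             ≡⟨ cong (length ∘ filter P?) (digits3-split m) ⟩
  length (filter P? (digits3⁺ q ++ digits3 r))               ≡⟨ cong length (filter-++ P? (digits3⁺ q) (digits3 r)) ⟩
  length (filter P? (digits3⁺ q) ++ filter P? (digits3 r))   ≡⟨ length-++ (filter P? (digits3⁺ q)) ⟩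
  length (filter P? (digits3⁺ q)) + count3 (suc d) r         ≡⟨ cong (_+ count3 (suc d) r) (count3-digits3⁺ q) ⟩
  count3 (suc d) q + count3 (suc d) r                        ∎
  where
  open ≡-Reasoning
  P? = _≟ suc d
  q = n / 3
  r = n % 3
  count3-digits3⁺ : ∀ q → length (filter P? (digits3⁺ q)) ≡ count3 (suc d) q
  count3-digits3⁺ zero = refl
  count3-digits3⁺ (suc _) = refl

ternary-induction : (P : ℕ → Set) → P 0 → (∀ m → P (suc m / 3) → P (suc m)) → ∀ n → P n
ternary-induction P p₀ step = <-rec P go
  where
  go : ∀ n → (∀ {y} → y < n → P y) → P n
  go zero    _   = p₀
  go (suc m) rec = step m (rec (/3< m))

S13≡2^ones3*3^twos3 : ∀ n → S13 n ≡ 2 ^ ones3 n * 3 ^ twos3 n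
S13≡2^ones3*3^twos3 = ternary-induction _ refl step
  where
  digit : ∀ {r} → r < 3 → S13 r ≡ 2 ^ ones3 r * 3 ^ twos3 r
  digit = digit-cases (λ r → S13 r ≡ 2 ^ ones3 r * 3 ^ twos3 r) refl refl refl
  step : ∀ m → S13 (suc m / 3) ≡ 2 ^ ones3 (suc m / 3) * 3 ^ twos3 (suc m / 3) →
         S13 (suc m) ≡ 2 ^ ones3 (suc m) * 3 ^ twos3 (suc m)
  step m ih = begin
    S13 n                                          ≡⟨ S13-/3 n ⟩
    S13 q * S13 r                                  ≡⟨ cong₂ _*_ ih (digit (m%n<n n 3)) ⟩
    (2 ^ ones3 q * 3 ^ twos3 q) * (2 ^ ones3 r * 3 ^ twos3 r)
                                                   ≡⟨ *-interchange (2 ^ ones3 q) _ _ _ ⟩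
    (2 ^ ones3 q * 2 ^ ones3 r) * (3 ^ twos3 q * 3 ^ twos3 r)
                                                   ≡⟨ cong₂ _*_ (^-distribˡ-+-* 2 (ones3 q) (ones3 r)) (^-distribˡ-+-* 3 (twos3 q) (twos3 r)) ⟨
    2 ^ (ones3 q + ones3 r) * 3 ^ (twos3 q + twos3 r)
                                                   ≡⟨ cong₂ (λ a b → 2 ^ a * 3 ^ b) (count3-/3 0 n) (count3-/3 1 n) ⟨
    2 ^ ones3 n * 3 ^ twos3 n                   ∎
    where
    open ≡-Reasoning
    n = suc m
    q = n / 3
    r = n % 3

S13-*3 : ∀ x → S13 (x * 3) ≡ S13 x
S13-*3 x = begin
  S13 (x * 3)                          ≡⟨ S13-/3 (x * 3) ⟩
  S13 (x * 3 / 3) * S13 (x * 3 % 3)    ≡⟨ cong₂ (λ q r → S13 q * S13 r) (m*n/n≡m x 3) (m*n%n≡0 x 3) ⟩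
  S13 x * 1                            ≡⟨ *-identityʳ (S13 x) ⟩
  S13 x                                ∎
  where open ≡-Reasoning

S13-*3^ : ∀ x c → S13 (x * 3 ^ c) ≡ S13 x
S13-*3^ x zero    = cong S13 (*-identityʳ x)
S13-*3^ x (suc c) = begin
  S13 (x * (3 * 3 ^ c))   ≡⟨ cong S13 (trans (cong (x *_) (*-comm 3 (3 ^ c))) (sym (*-assoc x (3 ^ c) 3))) ⟩
  S13 (x * 3 ^ c * 3)     ≡⟨ S13-*3 (x * 3 ^ c) ⟩
  S13 (x * 3 ^ c)         ≡⟨ S13-*3^ x c ⟩
  S13 x                   ∎
  where open ≡-Reasoning

S13∘S13 : ∀ n {a} → ones3 n ≡ a → S13 (S13 n) ≡ S13 (2 ^ a)
S13∘S13 n refl = trans (cong S13 (S13≡2^ones3*3^twos3 n)) (S13-*3^ (2 ^ ones3 n) (twos3 n))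

2∣n+ones3 : ∀ n → 2 ∣ n + ones3 n
2∣n+ones3 = ternary-induction _ (divides 0 refl) step
  where
  digit : ∀ {r} → r < 3 → 2 ∣ r + ones3 r
  digit = digit-cases (λ r → 2 ∣ r + ones3 r) (divides 0 refl) (divides 1 refl) (divides 1 refl)
  regroup : ∀ q r a b → (r + q * 3) + (a + b) ≡ (q + a) + (r + b) + q * 2
  regroup = solve-∀
  step : ∀ m → 2 ∣ suc m / 3 + ones3 (suc m / 3) → 2 ∣ suc m + ones3 (suc m)
  step m ih = subst (2 ∣_) (sym n+ones3≡) (∣m∣n⇒∣m+n (∣m∣n⇒∣m+n ih (digit (m%n<n n 3))) (n∣m*n q))
    where
    n = suc m
    q = n / 3
    r = n % 3
    n+ones3≡ : n + ones3 n ≡ (q + ones3 q) + (r + ones3 r) + q * 2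
    n+ones3≡ = trans (cong₂ _+_ (m≡m%n+[m/n]*n n 3) (count3-/3 0 n)) (regroup q r (ones3 q) (ones3 r))

2∣ones3[2*k] : ∀ k → 2 ∣ ones3 (2 * k)
2∣ones3[2*k] k = ∣m+n∣m⇒∣n (2∣n+ones3 (2 * k)) (m∣m*n k)

ones3-%3≡1 : ∀ n → n % 3 ≡ 1 → 1 ≤ ones3 n
ones3-%3≡1 n n%3≡1 = begin
  1                            ≡⟨ cong ones3 n%3≡1 ⟨
  ones3 (n % 3)                ≤⟨ m≤n+m (ones3 (n % 3)) (ones3 (n / 3)) ⟩
  ones3 (n / 3) + ones3 (n % 3) ≡⟨ count3-/3 0 n ⟨
  ones3 n                      ∎
  where open ≤-Reasoning

4^t%3≡1 : ∀ t → 2 ^ (t * 2) % 3 ≡ 1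
4^t%3≡1 zero    = refl
4^t%3≡1 (suc t) = begin
  2 * (2 * 4^t) % 3               ≡⟨ %-distribˡ-* 2 (2 * 4^t) 3 ⟩
  2 * (2 * 4^t % 3) % 3           ≡⟨ cong (λ y → 2 * y % 3) (%-distribˡ-* 2 4^t 3) ⟩
  2 * (2 * (4^t % 3) % 3) % 3     ≡⟨ cong (λ y → 2 * (2 * y % 3) % 3) (4^t%3≡1 t) ⟩
  1                               ∎
  where
  open ≡-Reasoning
  4^t = 2 ^ (t * 2)

count3-<3^ : ∀ d L {x} → x < 3 ^ L → count3 (suc d) x ≤ L
count3-<3^ d zero    {zero}  _       = z≤n
count3-<3^ d zero    {suc _} (s≤s ())
count3-<3^ d (suc L) {x}     x<3^1+L = begin
  count3 (suc d) x                                   ≡⟨ count3-/3 d x ⟩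
  count3 (suc d) (x / 3) + count3 (suc d) (x % 3)    ≤⟨ +-mono-≤ (count3-<3^ d L x/3<3^L) (digit≤1 (m%n<n x 3)) ⟩
  L + 1                                              ≡⟨ +-comm L 1 ⟩
  suc L                                              ∎
  where
  open ≤-Reasoning
  x/3<3^L : x / 3 < 3 ^ L
  x/3<3^L = m<n*o⇒m/o<n (subst (x <_) (*-comm 3 (3 ^ L)) x<3^1+L)
  digit≤1 : ∀ {r} → r < 3 → count3 (suc d) r ≤ 1
  digit≤1 {r} r<3 = subst (λ ds → length (filter (_≟ suc d) ds) ≤ 1) (sym (digits3-digit r<3))
                          (length-filter (_≟ suc d) (r ∷ []))

4^[2+t]<3^[3+2t] : ∀ t → 2 ^ (suc (suc t) * 2) < 3 ^ (3 + t * 2)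
4^[2+t]<3^[3+2t] zero    = m≤m+n 17 10
4^[2+t]<3^[3+2t] (suc t) = begin-strict
  2 * (2 * 2 ^ (suc (suc t) * 2))   <⟨ *-monoʳ-< 2 (*-monoʳ-< 2 (4^[2+t]<3^[3+2t] t)) ⟩
  2 * (2 * 3^[3+2t])                ≤⟨ *-monoʳ-≤ 2 (*-monoˡ-≤ 3^[3+2t] 2≤3) ⟩
  2 * (3 * 3^[3+2t])                ≤⟨ *-monoˡ-≤ (3 * 3^[3+2t]) 2≤3 ⟩
  3 * (3 * 3^[3+2t])                ∎
  where
  open ≤-Reasoning
  3^[3+2t] = 3 ^ (3 + t * 2)
  2≤3 = n≤1+n 2

ones3[4^[2+t]]< : ∀ t → ones3 (2 ^ (suc (suc t) * 2)) < suc (suc t) * 2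
ones3[4^[2+t]]< t = s≤s (count3-<3^ 0 (3 + t * 2) (4^[2+t]<3^[3+2t] t))

even-positive : ∀ {m} → 2 ∣ m → 1 ≤ m → ∃[ s ] m ≡ suc s * 2
even-positive (divides zero    refl) ()
even-positive (divides (suc s) m≡)   _ = s , m≡

S13[2^[1+a]] : ∀ a → 1 ≤ ones3 (2 ^ suc a) →
  ∃[ s ] (ones3 (2 ^ suc a) ≡ suc s * 2 × S13 (2 ^ suc a) ≡ 2 ^ (suc s * 2) * 3 ^ twos3 (2 ^ suc a))
S13[2^[1+a]] a pos =
  let s , ones≡ = even-positive (2∣ones3[2*k] (2 ^ a)) pos
  in s , ones≡ , trans (S13≡2^ones3*3^twos3 (2 ^ suc a)) (cong (λ e → 2 ^ e * 3 ^ twos3 (2 ^ suc a)) ones≡)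

Is4^·3^ : ℕ → Set
Is4^·3^ x = ∃[ t ] ∃[ c ] x ≡ 2 ^ (suc t * 2) * 3 ^ c

Is4^·3^-S13[2^[1+a]] : ∀ a → 1 ≤ ones3 (2 ^ suc a) → Is4^·3^ (S13 (2 ^ suc a))
Is4^·3^-S13[2^[1+a]] a pos = let s , _ , S13≡ = S13[2^[1+a]] a pos in s , twos3 (2 ^ suc a) , S13≡

Is4^·3^-S13 : ∀ {x} → Is4^·3^ x → Is4^·3^ (S13 x)
Is4^·3^-S13 (t , c , refl) = subst Is4^·3^ (sym (S13-*3^ (2 ^ (suc t * 2)) c))
  (Is4^·3^-S13[2^[1+a]] (suc (t * 2)) (ones3-%3≡1 (2 ^ (suc t * 2)) (4^t%3≡1 (suc t))))

Is4^·3^-iter : ∀ {x} → Is4^·3^ x → ∀ k → Is4^·3^ (iter S13 k x)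
Is4^·3^-iter q zero    = q
Is4^·3^-iter q (suc k) = Is4^·3^-S13 (Is4^·3^-iter q k)

Is4^·3^⇒4≤ : ∀ {x} → Is4^·3^ x → 4 ≤ x
Is4^·3^⇒4≤ (t , c , refl) = ≤-trans (*-monoʳ-≤ 2 (*-monoʳ-≤ 2 (m^n>0 2 (t * 2))))
                                     (m≤m*n (2 ^ (suc t * 2)) (3 ^ c) {{m^n≢0 3 c}})

iter-suc : ∀ (f : ℕ → ℕ) k x → iter f (suc k) x ≡ iter f k (f x)
iter-suc f zero    x = refl
iter-suc f (suc k) x = cong f (iter-suc f k x)

Is4^·3^-reaches-4 : ∀ {x} → Is4^·3^ x → ∃[ k ] iter S13 k x ≡ 4
Is4^·3^-reaches-4 (t , c , refl) = <-rec P go t c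
  where
  P : ℕ → Set
  P t = ∀ c → ∃[ k ] iter S13 k (2 ^ (suc t * 2) * 3 ^ c) ≡ 4
  go : ∀ t → (∀ {s} → s < t → P s) → P t
  go zero    _  c = 1 , S13-*3^ 4 c
  go (suc t) ih c =
    let s , ones≡ , S13≡ = S13[2^[1+a]] (suc (suc t * 2)) (ones3-%3≡1 4^[2+t] (4^t%3≡1 (suc (suc t))))
        s<1+t = s≤s⁻¹ (*-cancelʳ-< 2 (suc s) (suc (suc t)) (subst (_< suc (suc t) * 2) ones≡ (ones3[4^[2+t]]< t)))
        k , reach = ih s<1+t (twos3 4^[2+t])
    in suc k , trans (iter-suc S13 k (4^[2+t] * 3 ^ c))
                     (trans (cong (iter S13 k) (trans (S13-*3^ 4^[2+t] c) S13≡)) reach)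
    where 4^[2+t] = 2 ^ (suc (suc t) * 2)

count≡0⇒∉ : ∀ {d} xs → length (filter (_≟ d) xs) ≡ 0 → d ∉ xs
count≡0⇒∉ {d} xs count≡0 d∈xs with filter (_≟ d) xs | ∈-filter⁺ (_≟ d) d∈xs refl
count≡0⇒∉ {d} xs ()      d∈xs | _ ∷ _ | _

count>0⇒∈ : ∀ {d} xs → 0 < length (filter (_≟ d) xs) → d ∈ xs
count>0⇒∈ {d} xs pos with filter (_≟ d) xs in filter≡
... | y ∷ _ with ∈-filter⁻ (_≟ d) {xs = xs} (subst (y ∈_) (sym filter≡) (here refl))
...   | y∈xs , refl = y∈xs

ones3≡0⇒NoOne3 : ∀ n → ones3 n ≡ 0 → NoOne3 n
ones3≡0⇒NoOne3 n = count≡0⇒∉ (digits3 n)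

ones3≡1+⇒¬NoOne3 : ∀ n {k} → ones3 n ≡ suc k → ¬ NoOne3 n
ones3≡1+⇒¬NoOne3 n ones≡ no = no (count>0⇒∈ (digits3 n) (subst (0 <_) (sym ones≡) (s≤s z≤n)))

InCycle : ℕ → Set
InCycle x = x ≡ 2 ⊎ x ≡ 3

InCycle-S13 : ∀ {x} → InCycle x → InCycle (S13 x)
InCycle-S13 (inj₁ refl) = inj₂ refl
InCycle-S13 (inj₂ refl) = inj₁ refl

InCycle⇒¬Is4^·3^ : ∀ {x} → InCycle x → ¬ Is4^·3^ x
InCycle⇒¬Is4^·3^ (inj₁ refl) q = <⇒≱ (n≤1+n 3) (Is4^·3^⇒4≤ q)
InCycle⇒¬Is4^·3^ (inj₂ refl) q = <⇒≱ ≤-refl (Is4^·3^⇒4≤ q)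

EntersCycle : ℕ → Set
EntersCycle n = ∃[ k ] (1 ≤ k × InCycle (iter S13 k n))

Dichotomy : ℕ → Set → Set
Dichotomy n C = (EntersCycle n ⇔ C) × (¬ C → ∃[ k ] iter S13 k n ≡ 4)

dichotomy-cycle : ∀ {n C} k → InCycle (iter S13 (suc k) n) → C → Dichotomy n C
dichotomy-cycle k cyc c = mk⇔ (λ _ → c) (λ _ → suc k , s≤s z≤n , cyc) , λ ¬c → contradiction c ¬c

dichotomy-fixed : ∀ {n C} → ¬ C → Is4^·3^ (iter S13 2 n) → Dichotomy n C
dichotomy-fixed {n} ¬c q = mk⇔ (λ { (k , 1≤k , cyc) → ⊥-elim (never k 1≤k cyc) }) (λ c → contradiction c ¬c)
                         , λ _ → reach (Is4^·3^-reaches-4 q)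
  where
  after-two : ∀ k → iter S13 (suc (suc k)) n ≡ iter S13 k (iter S13 2 n)
  after-two k = trans (iter-suc S13 (suc k) n) (iter-suc S13 k (S13 n))
  never : ∀ k → 1 ≤ k → ¬ InCycle (iter S13 k n)
  never (suc k) _ cyc = InCycle⇒¬Is4^·3^ (subst InCycle (after-two k) (InCycle-S13 cyc)) (Is4^·3^-iter q k)
  reach : ∃[ k ] iter S13 k (iter S13 2 n) ≡ 4 → ∃[ k ] iter S13 k n ≡ 4
  reach (k , ≡4) = suc (suc k) , trans (after-two k) ≡4

theorem8 : ∀ (n : ℕ) → 1 ≤ n →
    ((∃[ k ] (1 ≤ k × (iter S13 k n ≡ 2 ⊎ iter S13 k n ≡ 3)))
    ⇔ (NoOne3 n ⊎ NoOne3 (2 ^ ones3 n)))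
    × (¬ (NoOne3 n ⊎ NoOne3 (2 ^ ones3 n)) → ∃[ k ] (iter S13 k n ≡ 4))
theorem8 n _ with ones3 n in ones3[n]
... | zero = dichotomy-cycle 1 (inj₁ (S13∘S13 n ones3[n])) (inj₁ (ones3≡0⇒NoOne3 n ones3[n]))
... | suc a with ones3 (2 ^ suc a) in ones3[2^a]
...   | zero = dichotomy-cycle 2 (inj₁ (trans (cong S13 (S13∘S13 n ones3[n])) (S13∘S13 (2 ^ suc a) ones3[2^a])))
                                 (inj₂ (ones3≡0⇒NoOne3 (2 ^ suc a) ones3[2^a]))
...   | suc b = dichotomy-fixed [ ones3≡1+⇒¬NoOne3 n ones3[n] , ones3≡1+⇒¬NoOne3 (2 ^ suc a) ones3[2^a] ]
                  (subst Is4^·3^ (sym (S13∘S13 n ones3[n]))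
                    (Is4^·3^-S13[2^[1+a]] a (subst (1 ≤_) (sym ones3[2^a]) (s≤s z≤n))))
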